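{- Let $A$ be a type (set) and $R$ a binary relation on $A$ that is reflexive ($R\,x\,x$ for all $x$) and antisymmetric ($R\,x\,y$ and $R\,y\,x$ imply $x=y$); transitivity is not assumed. Suppose $R$ is complete, i.e. every chain has a least upper bound. Let $\bot\in A$ satisfy $R\,\bot\,x$ for all $x\in A$, and let $f:A\to A$ be continuous (from $(A,R)$ to $(A,R)$). Then there exists $\phi\in A$ that is a least fixpoint of $f$ for $R$.
   Context: A chain for $R$ is a sequence $(u_n)_{n\in\mathbb{N}}$ in $A$ with $R\,u_n\,u_{n+1}$ for all $n$. An upper bound of $(u_n)$ is $u$ with $R\,u_n\,u$ for all $n$; a least upper bound is an upper bound $u$ such that $R\,u\,v$ for every upper bound $v$. A function $f:A\to B$ between $(A,R)$ and $(B,R')$ is continuous if for every chain $(u_n)$ in $(A,R)$ and every least upper bound $u$ of $(u_n)$, $f(u)$ is a least upper bound of $(f(u_n))$ in $(B,R')$ (monotonicity is not part of the definition). $\phi$ is a least fixpoint of $f$ for $R$ if $f(\phi)=\phi$ and $R\,\phi\,\psi$ for every $\psi$ with $f(\psi)=\psi$. -}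

module Defs where

open import Data.Nat using (ℕ; suc)
open import Data.Product using (Σ; _×_)
open import Relation.Binary.PropositionalEquality using (_≡_)

module _ {A : Set} (R : A → A → Set) where

  Reflexive : Set
  Reflexive = ∀ x → R x x

  Antisymmetric : Set
  Antisymmetric = ∀ x y → R x y → R y x → x ≡ y

  IsChain : (ℕ → A) → Set
  IsChain u = ∀ n → R (u n) (u (suc n))

  IsUpperBound : (ℕ → A) → A → Set
  IsUpperBound u b = ∀ n → R (u n) b

  IsLub : (ℕ → A) → A → Set
  IsLub u b = IsUpperBound u b × (∀ v → IsUpperBound u v → R b v)

  Complete : Set
  Complete = ∀ u → IsChain u → Σ A (λ b → IsLub u b)

  IsBottom : A → Set
  IsBottom ⊥ = ∀ x → R ⊥ x

  IsLeastFixpoint : (A → A) → A → Set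
  IsLeastFixpoint f φ = (f φ ≡ φ) × (∀ ψ → f ψ ≡ ψ → R φ ψ)

-- continuity between (A, R) and (B, R'); monotonicity not included
Continuous : {A B : Set} (R : A → A → Set) (R' : B → B → Set) → (A → B) → Set
Continuous {A} R R' f =
  ∀ (u : ℕ → A) → IsChain R u → ∀ b → IsLub R u b → IsLub R' (λ n → f (u n)) (f b)

{-# OPTIONS --safe #-}
module Submission where

open import Defs
open import Data.Product using (Σ; _,_; proj₁; proj₂)
open import Data.Nat using (ℕ; zero; suc)
open import Data.Nat.GeneralisedArithmetic using (fold)
open import Relation.Binary.PropositionalEquality using (_≡_; subst)

-- Kleene's construction: the iterates ⊥, f ⊥, f (f ⊥), … form a chain whose
-- least upper bound φ is the least fixpoint. Monotonicity of f is recovered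
-- from continuity on the chain x, y, y, …, and f φ = φ because f φ and φ are
-- least upper bounds of the same chain up to its first element ⊥.

module _ {A : Set} (R : A → A → Set) where

  Monotone : (A → A) → Set
  Monotone f = ∀ {x y} → R x y → R (f x) (f y)

  lub-unique : Antisymmetric R → ∀ {u b b′} → IsLub R u b → IsLub R u b′ → b ≡ b′
  lub-unique anti {b = b} {b′} (b-ub , b-least) (b′-ub , b′-least) =
    anti b b′ (b-least b′ b′-ub) (b′-least b b-ub)

  lub-cons : ∀ {u b} → R (u 0) b → IsLub R (λ n → u (suc n)) b → IsLub R u b
  lub-cons {u} u₀≤b (tail-ub , tail-least) = ub , λ v v-ub → tail-least v (λ n → v-ub (suc n))
    where
    ub : IsUpperBound R u _
    ub zero    = u₀≤b
    ub (suc n) = tail-ub n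

  fold-isChain : ∀ {f x} → Monotone f → R x (f x) → IsChain R (fold x f)
  fold-isChain mono x≤fx zero    = x≤fx
  fold-isChain mono x≤fx (suc n) = mono (fold-isChain mono x≤fx n)

  fold-below-fixpoint : ∀ {f x ψ} → Monotone f → f ψ ≡ ψ → R x ψ → IsUpperBound R (fold x f) ψ
  fold-below-fixpoint mono fψ≡ψ x≤ψ zero    = x≤ψ
  fold-below-fixpoint mono fψ≡ψ x≤ψ (suc n) =
    subst (R _) fψ≡ψ (mono (fold-below-fixpoint mono fψ≡ψ x≤ψ n))

continuous⇒monotone : {A : Set} {R : A → A → Set} {f : A → A}
  → Reflexive R → Continuous R R f → Monotone R f
continuous⇒monotone {A} {R} {f} refl′ cont {x} {y} x≤y =
  proj₁ (cont step step-isChain y step-lub) 0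
  where
  step : ℕ → A
  step zero    = x
  step (suc _) = y

  step-isChain : IsChain R step
  step-isChain zero    = x≤y
  step-isChain (suc _) = refl′ y

  step-lub : IsLub R step y
  step-lub = lub-cons R x≤y ((λ _ → refl′ y) , λ v v-ub → v-ub 0)

mainTheorem1 : (A : Set) (R : A → A → Set)
    → Reflexive R → Antisymmetric R → Complete R
    → (⊥ : A) → IsBottom R ⊥
    → (f : A → A) → Continuous R R f
    → Σ A (λ φ → IsLeastFixpoint R f φ)
mainTheorem1 A R refl′ anti complete ⊥ bottom f cont = φ , fφ≡φ , least
  where
  mono : Monotone R f
  mono = continuous⇒monotone refl′ cont

  kleene-isChain : IsChain R (fold ⊥ f)
  kleene-isChain = fold-isChain R mono (bottom (f ⊥))

  φ : A
  φ = proj₁ (complete (fold ⊥ f) kleene-isChain)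

  φ-lub : IsLub R (fold ⊥ f) φ
  φ-lub = proj₂ (complete (fold ⊥ f) kleene-isChain)

  fφ≡φ : f φ ≡ φ
  fφ≡φ = lub-unique R anti (lub-cons R (bottom (f φ)) (cont _ kleene-isChain φ φ-lub)) φ-lub

  least : ∀ ψ → f ψ ≡ ψ → R φ ψ
  least ψ fψ≡ψ = proj₂ φ-lub ψ (fold-below-fixpoint R mono fψ≡ψ (bottom ψ))
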